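{- Let $n\ge 9$ and $G\in S_n$. Let $e_1,e_2,\dots,e_t$ be distinct edges of $G$, each having at most one endvertex in $C_{\chi}(G)$, and let $n_1,\dots,n_t$ be positive even integers. For every $i$, $1\le i\le t$, subdivide $e_i$ with $n_i$ new vertices (i.e. replace $e_i$ by a path with $n_i$ new internal vertices), and denote the resulting graph by $H$. Then $\Delta(H)=4$, $\chi(H)=3$, ${\rm ivs_{\chi}}(H)=3$ and ${\rm vs_{\chi}}(H)=2$; that is, $H\in S_{n+n_1+\cdots+n_t}$.
   Context: All graphs are finite and simple. $\chi(G)$ is the chromatic number and $\Delta(G)$ the maximum degree of $G$. ${\rm vs_{\chi}}(G)$ is the minimum size of a set $S\subseteq V(G)$ such that $\chi(G-S)=\chi(G)-1$; ${\rm ivs_{\chi}}(G)$ is the minimum size of an independent set $S\subseteq V(G)$ such that $\chi(G-S)=\chi(G)-1$. For $n\ge 9$, $S_n$ denotes the set of graphs $G$ on $n$ vertices with $\Delta(G)=4$, $\chi(G)=3$, ${\rm ivs_{\chi}}(G)=3$ and ${\rm vs_{\chi}}(G)=2$. For a graph $G$, $C_{\chi}(G)$ denotes the set of vertices $x\in V(G)$ for which there exists $y\in V(G)$ with $\chi(G-\{x,y\})=2$. -}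

module Defs where

open import Data.Nat using (ℕ; zero; suc; _+_; _*_; _∸_; _≤_; _<_; _≡ᵇ_)
open import Data.Nat.Properties using (≤-trans; m≤m+n)
open import Data.Nat.Divisibility using (_∣_)
open import Data.Bool using (Bool; true; false; _∧_; _∨_; not)
open import Data.Fin using (Fin; toℕ; splitAt; inject≤; _≟_)
open import Data.Fin.Subset using (Subset; _∈_; _∉_; ∣_∣; ⁅_⁆; _∪_)
open import Data.Vec using (tabulate)
open import Data.List using (List; []; _∷_)
open import Data.List.Relation.Unary.All using (All)
open import Data.List.Relation.Unary.AllPairs using (AllPairs)
open import Data.Product using (Σ; ∃; _×_; _,_)
open import Data.Sum using (_⊎_; inj₁; inj₂)
open import Relation.Nullary using (¬_; ⌊_⌋)
open import Relation.Binary.PropositionalEquality using (_≡_; _≢_)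

Graph : ℕ → Set
Graph n = Fin n → Fin n → Bool

Simple : ∀ {n} → Graph n → Set
Simple {n} G = (∀ u v → G u v ≡ G v u) × (∀ v → G v v ≡ false)

deg : ∀ {n} → Graph n → Fin n → ℕ
deg G v = ∣ tabulate (G v) ∣

MaxDegree : ∀ {n} → Graph n → ℕ → Set
MaxDegree G d = (∀ v → deg G v ≤ d) × (∃ λ v → deg G v ≡ d)

Colorable : ∀ {n} → Graph n → ℕ → Set
Colorable {n} G k =
  Σ (Fin n → Fin k) λ c → ∀ u v → G u v ≡ true → c u ≢ c v

Chi : ∀ {n} → Graph n → ℕ → Set
Chi G k = Colorable G k × (∀ m → m < k → ¬ Colorable G m)

ColorableMinus : ∀ {n} → Graph n → Subset n → ℕ → Set
ColorableMinus {n} G S k =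
  Σ ((v : Fin n) → v ∉ S → Fin k) λ c →
    ∀ u v (pu : u ∉ S) (pv : v ∉ S) → G u v ≡ true → c u pu ≢ c v pv

ChiMinus : ∀ {n} → Graph n → Subset n → ℕ → Set
ChiMinus G S k = ColorableMinus G S k × (∀ m → m < k → ¬ ColorableMinus G S m)

Reduces : ∀ {n} → Graph n → Subset n → Set
Reduces G S = ∃ λ k → Chi G k × ChiMinus G S (k ∸ 1)

Independent : ∀ {n} → Graph n → Subset n → Set
Independent G S = ∀ u v → u ∈ S → v ∈ S → G u v ≡ false

Vs : ∀ {n} → Graph n → ℕ → Set
Vs {n} G m =
  (Σ (Subset n) λ S → ∣ S ∣ ≡ m × Reduces G S)
  × (∀ S → Reduces G S → m ≤ ∣ S ∣)

Ivs : ∀ {n} → Graph n → ℕ → Set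
Ivs {n} G m =
  (Σ (Subset n) λ S → ∣ S ∣ ≡ m × Independent G S × Reduces G S)
  × (∀ S → Independent G S → Reduces G S → m ≤ ∣ S ∣)

InS : ∀ {n} → Graph n → Set
InS {n} G =
  9 ≤ n × Simple G × MaxDegree G 4 × Chi G 3 × Ivs G 3 × Vs G 2

InC : ∀ {n} → Graph n → Fin n → Set
InC G x = ∃ λ y → ChiMinus G (⁅ x ⁆ ∪ ⁅ y ⁆) 2

private
  eqF : ∀ {n} → Fin n → Fin n → Bool
  eqF a b = ⌊ a ≟ b ⌋

-- Subdivide the edge uv of G (on m vertices) by k new vertices
-- m, m+1, ..., m+k-1 : the edge uv is removed and replaced by the path
-- u - m - (m+1) - ... - (m+k-1) - v.  (Intended for k ≥ 1.)
subdivideOne : ∀ {m} → Graph m → Fin m → Fin m → (k : ℕ) → Graph (m + k)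
subdivideOne {m} G u v k x y with splitAt m x | splitAt m {k} y
... | inj₁ a | inj₁ b =
  G a b ∧ not ((eqF a u ∧ eqF b v) ∨ (eqF a v ∧ eqF b u))
... | inj₁ a | inj₂ j =
  (eqF a u ∧ (toℕ j ≡ᵇ 0)) ∨ (eqF a v ∧ (suc (toℕ j) ≡ᵇ k))
... | inj₂ i | inj₁ b =
  (eqF b u ∧ (toℕ i ≡ᵇ 0)) ∨ (eqF b v ∧ (suc (toℕ i) ≡ᵇ k))
... | inj₂ i | inj₂ j =
  (suc (toℕ i) ≡ᵇ toℕ j) ∨ (suc (toℕ j) ≡ᵇ toℕ i)

-- An edge to subdivide: its two endpoints and the number of new vertices.
Sub : ℕ → Set
Sub n = Fin n × Fin n × ℕ

size : ∀ {n} → ℕ → List (Sub n) → ℕ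
size m [] = m
size m ((_ , _ , k) ∷ es) = size (m + k) es

-- Subdivide successively all listed edges (endpoints are vertices of the
-- original graph on n vertices, which keep their indices).
subdivideFrom : ∀ {n m} → Graph m → n ≤ m → (es : List (Sub n)) → Graph (size m es)
subdivideFrom G p [] = G
subdivideFrom {n} {m} G p ((u , v , k) ∷ es) =
  subdivideFrom (subdivideOne G (inject≤ u p) (inject≤ v p) k)
                (≤-trans p (m≤m+n m k)) es

subdivide : ∀ {n} → Graph n → (es : List (Sub n)) → Graph (size n es)
subdivide G es = subdivideFrom G (Data.Nat.Properties.≤-refl) es

totalNew : ∀ {n} → List (Sub n) → ℕ
totalNew [] = 0
totalNew ((_ , _ , k) ∷ es) = k + totalNew es

DistinctEdges : ∀ {n} → Sub n → Sub n → Set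
DistinctEdges (u , v , _) (u' , v' , _) =
  ¬ ((u ≡ u' × v ≡ v') ⊎ (u ≡ v' × v ≡ u'))

GoodSub : ∀ {n} → Graph n → Sub n → Set
GoodSub G (u , v , k) =
  G u v ≡ true × ¬ (InC G u × InC G v) × 1 ≤ k × 2 ∣ k

{-# OPTIONS --safe #-}
-- Subdividing an edge uv of G by an even number of new vertices replaces it by a path of
-- odd length, so 2- and 3-colourings of G minus a vertex set S extend to H minus (the
-- copy of) S, and conversely a 2-colouring of H - T restricts to one of G as long as T
-- misses the path.  If T does meet the path, the restriction 2-colours both G - {u, x}
-- and G - {v, x}, which would put both ends of uv into C_χ(G).  On 3-chromatic graphs,
-- vs_χ = 2 and ivs_χ = 3 amount to: deleting a non-adjacent pair (or a single vertex)
-- never leaves a bipartite graph, while some pair and some independent triple do.  By the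
-- two observations H inherits all of this from G; old vertices keep their degree and new
-- ones have degree 2, so Δ = 4 as well.
module Submission where

open import Defs
open import Data.Bool using (Bool; true; false; _∧_; _∨_; not; T)
open import Data.Empty using (⊥-elim)
open import Data.Fin using (Fin; zero; suc; toℕ; _≟_; _↑ˡ_; _↑ʳ_; splitAt; inject≤; fromℕ<; opposite)
open import Data.Fin.Properties
  using ( suc-injective; 0≢1+n; toℕ-injective; toℕ-fromℕ<; toℕ<n; ↑ˡ-injective; toℕ-↑ˡ
        ; inject≤-injective; toℕ-inject≤; inject≤-refl
        ; splitAt-↑ˡ; splitAt-↑ʳ; splitAt⁻¹-↑ˡ; splitAt⁻¹-↑ʳ )
open import Data.Fin.Subset using (Subset; _∈_; _∉_; ∣_∣; ⁅_⁆; _∪_; ⊥; _⊆_)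
open import Data.Fin.Subset.Properties
  using ( _∈?_; ∉⊥; ⊥⊆; x∈⁅x⁆; x∈⁅y⁆⇒x≡y; x∈p∪q⁻; x∈p∪q⁺; p⊆p∪q; q⊆p∪q
        ; ∪-identityˡ; ∪-identityʳ; ∪-idem; ∣⁅x⁆∣≡1; ∣⊥∣≡0 )
open import Data.Nat using (ℕ; zero; suc; _+_; _*_; _≤_; _<_; _≡ᵇ_; z≤n; s≤s)
import Data.Nat.Properties as ℕ
open import Data.Nat.Divisibility using (_∣_; divides)
open import Data.List using (List; []; _∷_)
open import Data.List.Relation.Unary.All using (All; []; _∷_)
import Data.List.Relation.Unary.All as All
open import Data.List.Relation.Unary.AllPairs using (AllPairs; []; _∷_)
open import Data.Bool.Properties using (∧-identityʳ; ∧-zeroʳ; ∨-zeroʳ; ∨-comm)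
open import Data.Product using (Σ; ∃; ∃₂; _×_; _,_; proj₁; proj₂)
import Data.Product as Product
open import Data.Sum using (_⊎_; inj₁; inj₂)
import Data.Sum as Sum
open import Data.Vec using (_∷_; []; here; there; tabulate; _++_)
open import Data.Vec.Properties using (tabulate-cong)
open import Function using (_∘_; id)
open import Relation.Nullary using (¬_; Dec; yes; no; contradiction; ⌊_⌋)
open import Relation.Nullary.Decidable using (_×-dec_; _⊎-dec_; isYes≗does; dec-true)
open import Relation.Binary using (tri<; tri≈; tri>)
open import Relation.Binary.PropositionalEquality
  using (_≡_; _≢_; refl; sym; trans; cong; cong₂; subst; module ≡-Reasoning)

Proper : ∀ {n k} → Graph n → Subset n → (Fin n → Fin k) → Set
Proper G S c = ∀ x y → x ∉ S → y ∉ S → G x y ≡ true → c x ≢ c y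

-- Total colourings, unlike those of ColorableMinus, which are only defined off S; for
-- k ≥ 1 the two notions agree, and total ones are easier to transport.
Colourable∖ : ∀ {n} → Graph n → Subset n → ℕ → Set
Colourable∖ {n} G S k = Σ (Fin n → Fin k) (Proper G S)

Bipartite∖ : ∀ {n} → Graph n → Subset n → Set
Bipartite∖ G S = Colourable∖ G S 2

Fin1-≡ : (i j : Fin 1) → i ≡ j
Fin1-≡ zero zero = refl

Fin2-≢-≢ : {a b c : Fin 2} → a ≢ b → a ≢ c → b ≡ c
Fin2-≢-≢ {zero}     {zero}     a≢b _   = contradiction refl a≢b
Fin2-≢-≢ {suc zero} {suc zero} a≢b _   = contradiction refl a≢b
Fin2-≢-≢ {zero}     {suc zero} {zero}     _ a≢c = contradiction refl a≢c
Fin2-≢-≢ {zero}     {suc zero} {suc zero} _ _   = refl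
Fin2-≢-≢ {suc zero} {zero}     {zero}     _ _   = refl
Fin2-≢-≢ {suc zero} {zero}     {suc zero} _ a≢c = contradiction refl a≢c

opposite-≢ : (a : Fin 2) → a ≢ opposite a
opposite-≢ zero       ()
opposite-≢ (suc zero) ()

module _ {n} {G : Graph n} where

  colourable∖⇒colorableMinus : ∀ {S k} → Colourable∖ G S k → ColorableMinus G S k
  colourable∖⇒colorableMinus (c , proper) = (λ x _ → c x) , λ x y x∉S y∉S → proper x y x∉S y∉S

  colorableMinus⇒colourable∖ : ∀ {S k} → ColorableMinus G S (suc k) → Colourable∖ G S (suc k)
  colorableMinus⇒colourable∖ {S} (c , proper) = c′ , proper′
    where
    c′ : Fin n → Fin _
    c′ x with x ∈? S
    ... | yes _   = zero
    ... | no  x∉S = c x x∉S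
    proper′ : Proper G S c′
    proper′ x y x∉S y∉S xy with x ∈? S | y ∈? S
    ... | yes x∈S | _       = contradiction x∈S x∉S
    ... | no _    | yes y∈S = contradiction y∈S y∉S
    ... | no x∉S′ | no y∉S′ = proper x y x∉S′ y∉S′ xy

  colorable⇒colourable∖⊥ : ∀ {k} → Colorable G k → Colourable∖ G ⊥ k
  colorable⇒colourable∖⊥ (c , proper) = c , λ x y _ _ → proper x y

  colourable∖⊥⇒colorable : ∀ {k} → Colourable∖ G ⊥ k → Colorable G k
  colourable∖⊥⇒colorable (c , proper) = c , λ x y → proper x y ∉⊥ ∉⊥

  colourable∖-⊆ : ∀ {S T k} → S ⊆ T → Colourable∖ G S k → Colourable∖ G T k
  colourable∖-⊆ S⊆T (c , proper) = c , λ x y x∉T y∉T → proper x y (x∉T ∘ S⊆T) (y∉T ∘ S⊆T)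

  colorable-≤ : ∀ {k l} → k ≤ l → Colorable G k → Colorable G l
  colorable-≤ k≤l (c , proper) =
    (λ x → inject≤ (c x) k≤l) , λ x y xy → proper x y xy ∘ inject≤-injective k≤l k≤l _ _

  colorableMinus-≤ : ∀ {S k l} → k ≤ l → ColorableMinus G S k → ColorableMinus G S l
  colorableMinus-≤ k≤l (c , proper) =
    (λ x x∉S → inject≤ (c x x∉S) k≤l) ,
    λ x y x∉S y∉S xy → proper x y x∉S y∉S xy ∘ inject≤-injective k≤l k≤l _ _

  colorableMinus-∪⁅⁆-1⇒bipartite∖ : (∀ x → G x x ≡ false) → ∀ {S} y →
    ColorableMinus G (S ∪ ⁅ y ⁆) 1 → Bipartite∖ G S
  colorableMinus-∪⁅⁆-1⇒bipartite∖ irrefl {S} y (c , proper) = c′ , proper′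
    where
    c′ : Fin n → Fin 2
    c′ x with x ≟ y
    ... | yes _ = suc zero
    ... | no  _ = zero
    ∉S∪⁅y⁆ : ∀ {x} → x ∉ S → x ≢ y → x ∉ S ∪ ⁅ y ⁆
    ∉S∪⁅y⁆ {x} x∉S x≢y x∈ with x∈p∪q⁻ S ⁅ y ⁆ x∈
    ... | inj₁ x∈S  = x∉S x∈S
    ... | inj₂ x∈⁅y⁆ = x≢y (x∈⁅y⁆⇒x≡y y x∈⁅y⁆)
    proper′ : Proper G S c′
    proper′ x y′ x∉S y′∉S xy with x ≟ y | y′ ≟ y
    ... | yes refl | yes refl = λ _ → contradiction (trans (sym xy) (irrefl x)) λ ()
    ... | yes _    | no  _    = λ ()
    ... | no  _    | yes _    = λ ()
    ... | no x≢y   | no y′≢y  = λ _ → proper x y′ (∉S∪⁅y⁆ x∉S x≢y) (∉S∪⁅y⁆ y′∉S y′≢y) xy (Fin1-≡ _ _)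

  independent-colorableMinus-1⇒bipartite : ∀ {S} → Independent G S →
    ColorableMinus G S 1 → Bipartite∖ G ⊥
  independent-colorableMinus-1⇒bipartite {S} independent (c , proper) = c′ , proper′
    where
    c′ : Fin n → Fin 2
    c′ x with x ∈? S
    ... | yes _ = suc zero
    ... | no  _ = zero
    proper′ : Proper G ⊥ c′
    proper′ x y _ _ xy with x ∈? S | y ∈? S
    ... | yes x∈S | yes y∈S = λ _ → contradiction (trans (sym xy) (independent x y x∈S y∈S)) λ ()
    ... | yes _   | no  _   = λ ()
    ... | no  _   | yes _   = λ ()
    ... | no x∉S  | no y∉S  = λ _ → proper x y x∉S y∉S xy (Fin1-≡ _ _)

ThreeChromatic : ∀ {n} → Graph n → Set
ThreeChromatic G = Colorable G 3 × ¬ Bipartite∖ G ⊥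

module _ {n} {G : Graph n} where

  threeChromatic⇒Chi : ThreeChromatic G → Chi G 3
  threeChromatic⇒Chi (col₃ , ¬bip) =
    col₃ , λ { m (s≤s m≤2) col → ¬bip (colorable⇒colourable∖⊥ (colorable-≤ m≤2 col)) }

  Chi⇒threeChromatic : Chi G 3 → ThreeChromatic G
  Chi⇒threeChromatic (col₃ , minimal) = col₃ , minimal 2 ℕ.≤-refl ∘ colourable∖⊥⇒colorable

  threeChromatic-Chi-unique : ThreeChromatic G → ∀ {k} → Chi G k → k ≡ 3
  threeChromatic-Chi-unique (col₃ , ¬bip) {k} (colₖ , minimal) with ℕ.<-cmp k 3
  ... | tri< (s≤s k≤2) _ _ = contradiction (colorable⇒colourable∖⊥ (colorable-≤ k≤2 colₖ)) ¬bip
  ... | tri≈ _ k≡3 _       = k≡3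
  ... | tri> _ _ 3<k       = contradiction col₃ (minimal 3 3<k)

  reduces⇒ChiMinus₂ : ThreeChromatic G → ∀ {S} → Reduces G S → ChiMinus G S 2
  reduces⇒ChiMinus₂ χ≡3 (k , χ≡k , χ₋≡k-1) with threeChromatic-Chi-unique χ≡3 χ≡k
  ... | refl = χ₋≡k-1

  reduces⇒bipartite∖ : ThreeChromatic G → ∀ {S} → Reduces G S → Bipartite∖ G S
  reduces⇒bipartite∖ χ≡3 = colorableMinus⇒colourable∖ ∘ proj₁ ∘ reduces⇒ChiMinus₂ χ≡3

  bipartite∖⇒reduces : ThreeChromatic G → ∀ {S} → Bipartite∖ G S → ¬ ColorableMinus G S 1 → Reduces G S
  bipartite∖⇒reduces χ≡3 bip ¬col₁ =
    3 , threeChromatic⇒Chi χ≡3 , colourable∖⇒colorableMinus bip ,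
    λ { m (s≤s m≤1) col → ¬col₁ (colorableMinus-≤ m≤1 col) }

  bipartite∖-∪⁅⁆⇒reduces : ThreeChromatic G → (∀ x → G x x ≡ false) → ∀ {S} y →
    ¬ Bipartite∖ G S → Bipartite∖ G (S ∪ ⁅ y ⁆) → Reduces G (S ∪ ⁅ y ⁆)
  bipartite∖-∪⁅⁆⇒reduces χ≡3 irrefl y ¬bip bip =
    bipartite∖⇒reduces χ≡3 bip (¬bip ∘ colorableMinus-∪⁅⁆-1⇒bipartite∖ irrefl y)

x∈⁅y⁆∪⁅z⁆⁻ : ∀ {n} {x y z : Fin n} → x ∈ ⁅ y ⁆ ∪ ⁅ z ⁆ → x ≡ y ⊎ x ≡ z
x∈⁅y⁆∪⁅z⁆⁻ {y = y} {z} x∈ with x∈p∪q⁻ ⁅ y ⁆ ⁅ z ⁆ x∈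
... | inj₁ x∈⁅y⁆ = inj₁ (x∈⁅y⁆⇒x≡y y x∈⁅y⁆)
... | inj₂ x∈⁅z⁆ = inj₂ (x∈⁅y⁆⇒x≡y z x∈⁅z⁆)

x∈⁅x⁆∪⁅y⁆ : ∀ {n} (x y : Fin n) → x ∈ ⁅ x ⁆ ∪ ⁅ y ⁆
x∈⁅x⁆∪⁅y⁆ x y = x∈p∪q⁺ (inj₁ (x∈⁅x⁆ x))

y∈⁅x⁆∪⁅y⁆ : ∀ {n} (x y : Fin n) → y ∈ ⁅ x ⁆ ∪ ⁅ y ⁆
y∈⁅x⁆∪⁅y⁆ x y = x∈p∪q⁺ (inj₂ (x∈⁅x⁆ y))

⁅x⁆∪⁅y⁆⊆ : ∀ {n} {x y : Fin n} {S} → x ∈ S → y ∈ S → ⁅ x ⁆ ∪ ⁅ y ⁆ ⊆ S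
⁅x⁆∪⁅y⁆⊆ x∈S y∈S z∈ with x∈⁅y⁆∪⁅z⁆⁻ z∈
... | inj₁ refl = x∈S
... | inj₂ refl = y∈S

⁅x⁆∪⁅y⁆⊆⁅y⁆∪⁅x⁆ : ∀ {n} (x y : Fin n) → ⁅ x ⁆ ∪ ⁅ y ⁆ ⊆ ⁅ y ⁆ ∪ ⁅ x ⁆
⁅x⁆∪⁅y⁆⊆⁅y⁆∪⁅x⁆ x y = ⁅x⁆∪⁅y⁆⊆ (y∈⁅x⁆∪⁅y⁆ y x) (x∈⁅x⁆∪⁅y⁆ y x)

∣p∣≤0⇒p⊆⊥ : ∀ {n} (p : Subset n) → ∣ p ∣ ≤ 0 → p ⊆ ⊥
∣p∣≤0⇒p⊆⊥ (false ∷ p) ∣p∣≤0 (there x∈p) = there (∣p∣≤0⇒p⊆⊥ p ∣p∣≤0 x∈p)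

∣p∣≤1⇒p⊆⁅x⁆ : ∀ {n} (p : Subset n) → ∣ p ∣ ≤ 1 → p ⊆ ⊥ ⊎ ∃ λ x → p ⊆ ⁅ x ⁆
∣p∣≤1⇒p⊆⁅x⁆ []          _          = inj₁ λ ()
∣p∣≤1⇒p⊆⁅x⁆ (true ∷ p)  (s≤s ∣p∣≤0) =
  inj₂ (zero , λ { here → here ; (there x∈p) → there (∣p∣≤0⇒p⊆⊥ p ∣p∣≤0 x∈p) })
∣p∣≤1⇒p⊆⁅x⁆ (false ∷ p) ∣p∣≤1 with ∣p∣≤1⇒p⊆⁅x⁆ p ∣p∣≤1
... | inj₁ p⊆⊥       = inj₁ λ { (there x∈p) → there (p⊆⊥ x∈p) }
... | inj₂ (x , p⊆⁅x⁆) = inj₂ (suc x , λ { (there y∈p) → there (p⊆⁅x⁆ y∈p) })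

∣p∣≤2⇒p⊆⁅x⁆∪⁅y⁆ : ∀ {n} (p : Subset n) → ∣ p ∣ ≤ 2 →
  p ⊆ ⊥ ⊎ ∃₂ λ x y → x ∈ p × y ∈ p × p ⊆ ⁅ x ⁆ ∪ ⁅ y ⁆
∣p∣≤2⇒p⊆⁅x⁆∪⁅y⁆ []          _          = inj₁ λ ()
∣p∣≤2⇒p⊆⁅x⁆∪⁅y⁆ (true ∷ p)  (s≤s ∣p∣≤1) with ∣p∣≤1⇒p⊆⁅x⁆ p ∣p∣≤1
... | inj₁ p⊆⊥ =
  inj₂ (zero , zero , here , here , λ { here → here ; (there x∈p) → ⊥-elim (∉⊥ (p⊆⊥ x∈p)) })
... | inj₂ (x , p⊆⁅x⁆) with x ∈? p
...   | yes x∈p = inj₂ (zero , suc x , here , there x∈p ,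
                    λ { here → here ; (there y∈p) → there (q⊆p∪q ⊥ ⁅ x ⁆ (p⊆⁅x⁆ y∈p)) })
...   | no  x∉p = inj₂ (zero , zero , here , here ,
                    λ { here → here ; (there y∈p) → ⊥-elim (∉⊥ (p⊆⊥ y∈p)) })
  where
  p⊆⊥ : p ⊆ ⊥
  p⊆⊥ {y} y∈p = contradiction (subst (_∈ p) (x∈⁅y⁆⇒x≡y x (p⊆⁅x⁆ y∈p)) y∈p) x∉p
∣p∣≤2⇒p⊆⁅x⁆∪⁅y⁆ (false ∷ p) ∣p∣≤2 with ∣p∣≤2⇒p⊆⁅x⁆∪⁅y⁆ p ∣p∣≤2
... | inj₁ p⊆⊥ = inj₁ λ { (there x∈p) → there (p⊆⊥ x∈p) }
... | inj₂ (x , y , x∈p , y∈p , p⊆) =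
  inj₂ (suc x , suc y , there x∈p , there y∈p , λ { (there z∈p) → there (p⊆ z∈p) })

∣⁅x⁆∪⁅y⁆∣≡2 : ∀ {n} {x y : Fin n} → x ≢ y → ∣ ⁅ x ⁆ ∪ ⁅ y ⁆ ∣ ≡ 2
∣⁅x⁆∪⁅y⁆∣≡2 {x = zero}  {zero}  x≢y = contradiction refl x≢y
∣⁅x⁆∪⁅y⁆∣≡2 {x = zero}  {suc y} _   = cong suc (trans (cong ∣_∣ (∪-identityˡ ⁅ y ⁆)) (∣⁅x⁆∣≡1 y))
∣⁅x⁆∪⁅y⁆∣≡2 {x = suc x} {zero}  _   = cong suc (trans (cong ∣_∣ (∪-identityʳ ⁅ x ⁆)) (∣⁅x⁆∣≡1 x))
∣⁅x⁆∪⁅y⁆∣≡2 {x = suc x} {suc y} x≢y = ∣⁅x⁆∪⁅y⁆∣≡2 (x≢y ∘ cong suc)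

∣⁅x⁆∪⁅y⁆∣≤2 : ∀ {n} (x y : Fin n) → ∣ ⁅ x ⁆ ∪ ⁅ y ⁆ ∣ ≤ 2
∣⁅x⁆∪⁅y⁆∣≤2 x y with x ≟ y
... | no x≢y  = ℕ.≤-reflexive (∣⁅x⁆∪⁅y⁆∣≡2 x≢y)
... | yes refl = ℕ.≤-trans (ℕ.≤-reflexive (trans (cong ∣_∣ (∪-idem ⁅ x ⁆)) (∣⁅x⁆∣≡1 x))) (ℕ.n≤1+n 1)

independent-pair : ∀ {n} {G : Graph n} → Simple G → ∀ {x y} → G x y ≡ false →
  Independent G (⁅ x ⁆ ∪ ⁅ y ⁆)
independent-pair (G-sym , G-irrefl) {x} {y} xy z w z∈ w∈ with x∈⁅y⁆∪⁅z⁆⁻ z∈ | x∈⁅y⁆∪⁅z⁆⁻ w∈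
... | inj₁ refl | inj₁ refl = G-irrefl z
... | inj₁ refl | inj₂ refl = xy
... | inj₂ refl | inj₁ refl = trans (G-sym z w) xy
... | inj₂ refl | inj₂ refl = G-irrefl z

AtMostOne : ∀ {n} → (Fin n → Set) → Set
AtMostOne P = ∀ {i j} → P i → P j → i ≡ j

∣tabulate∣-cong : ∀ {n} {f g : Fin n → Bool} → (∀ i → f i ≡ g i) → ∣ tabulate f ∣ ≡ ∣ tabulate g ∣
∣tabulate∣-cong f≗g = cong ∣_∣ (tabulate-cong f≗g)

∣p++q∣ : ∀ {m k} (p : Subset m) (q : Subset k) → ∣ p ++ q ∣ ≡ ∣ p ∣ + ∣ q ∣
∣p++q∣ []          q = refl
∣p++q∣ (true ∷ p)  q = cong suc (∣p++q∣ p q)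
∣p++q∣ (false ∷ p) q = ∣p++q∣ p q

tabulate-↑ : ∀ {A : Set} m k (f : Fin (m + k) → A) →
  tabulate f ≡ tabulate (f ∘ (_↑ˡ k)) ++ tabulate (f ∘ (m ↑ʳ_))
tabulate-↑ zero    k f = refl
tabulate-↑ (suc m) k f = cong (f zero ∷_) (tabulate-↑ m k (f ∘ suc))

∣tabulate∣-↑ : ∀ m k (f : Fin (m + k) → Bool) →
  ∣ tabulate f ∣ ≡ ∣ tabulate (f ∘ (_↑ˡ k)) ∣ + ∣ tabulate (f ∘ (m ↑ʳ_)) ∣
∣tabulate∣-↑ m k f = trans (cong ∣_∣ (tabulate-↑ m k f)) (∣p++q∣ (tabulate (f ∘ (_↑ˡ k))) _)

∣tabulate∣≡0 : ∀ {n} (f : Fin n → Bool) → (∀ i → f i ≢ true) → ∣ tabulate f ∣ ≡ 0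
∣tabulate∣≡0 {zero}  f _   = refl
∣tabulate∣≡0 {suc n} f f≢ with f zero in f0
... | true  = contradiction f0 (f≢ zero)
... | false = ∣tabulate∣≡0 (f ∘ suc) (f≢ ∘ suc)

∣tabulate∣≤1 : ∀ {n} (f : Fin n → Bool) → AtMostOne (λ i → f i ≡ true) → ∣ tabulate f ∣ ≤ 1
∣tabulate∣≤1 {zero}  f _      = z≤n
∣tabulate∣≤1 {suc n} f unique with f zero in f0
... | true  = s≤s (ℕ.≤-reflexive (∣tabulate∣≡0 (f ∘ suc) λ i fi → 0≢1+n (unique f0 fi)))
... | false = ∣tabulate∣≤1 (f ∘ suc) (λ fi fj → suc-injective (unique fi fj))

∣tabulate∣≡1 : ∀ {n} (f : Fin n → Bool) {i} → f i ≡ true → AtMostOne (λ i → f i ≡ true) →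
  ∣ tabulate f ∣ ≡ 1
∣tabulate∣≡1 {suc n} f {zero}  f0 unique rewrite f0 =
  cong suc (∣tabulate∣≡0 (f ∘ suc) λ i fi → 0≢1+n (unique f0 fi))
∣tabulate∣≡1 {suc n} f {suc i} fi unique with f zero in f0
... | true  = contradiction (unique f0 fi) 0≢1+n
... | false = ∣tabulate∣≡1 (f ∘ suc) fi (λ fi fj → suc-injective (unique fi fj))

∣tabulate∘suc∣≤1 : ∀ {n} (f : Fin (suc n) → Bool) {P Q : Fin (suc n) → Set} →
  AtMostOne P → AtMostOne Q → (∀ i → f i ≡ true → P i ⊎ Q i) → P zero → ∣ tabulate (f ∘ suc) ∣ ≤ 1
∣tabulate∘suc∣≤1 f uniqueP uniqueQ f⊆ P0 = ∣tabulate∣≤1 (f ∘ suc) λ fi fj → suc-injective (only-Q fi fj)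
  where
  only-Q : ∀ {i j} → f (suc i) ≡ true → f (suc j) ≡ true → suc i ≡ suc j
  only-Q {i} {j} fi fj with f⊆ (suc i) fi | f⊆ (suc j) fj
  ... | inj₁ Pi | _       = contradiction (uniqueP P0 Pi) 0≢1+n
  ... | inj₂ _  | inj₁ Pj = contradiction (uniqueP P0 Pj) 0≢1+n
  ... | inj₂ Qi | inj₂ Qj = uniqueQ Qi Qj

∣tabulate∣≤2 : ∀ {n} (f : Fin n → Bool) {P Q : Fin n → Set} → AtMostOne P → AtMostOne Q →
  (∀ i → f i ≡ true → P i ⊎ Q i) → ∣ tabulate f ∣ ≤ 2
∣tabulate∣≤2 {zero}  f _ _ _ = z≤n
∣tabulate∣≤2 {suc n} f uniqueP uniqueQ f⊆ with f zero in f0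
... | false = ∣tabulate∣≤2 (f ∘ suc) (λ p q → suc-injective (uniqueP p q))
                                    (λ p q → suc-injective (uniqueQ p q)) (f⊆ ∘ suc)
... | true with f⊆ zero f0
...   | inj₁ P0 = s≤s (∣tabulate∘suc∣≤1 f uniqueP uniqueQ f⊆ P0)
...   | inj₂ Q0 = s≤s (∣tabulate∘suc∣≤1 f uniqueQ uniqueP (λ i → Sum.swap ∘ f⊆ i) Q0)

∣b∷p∣≡suc∣b∷q∣ : ∀ b {n} {p q : Subset n} → ∣ p ∣ ≡ suc ∣ q ∣ → ∣ b ∷ p ∣ ≡ suc ∣ b ∷ q ∣
∣b∷p∣≡suc∣b∷q∣ true  = cong suc
∣b∷p∣≡suc∣b∷q∣ false e = e

∣tabulate∣-suc : ∀ {n} (f g : Fin n → Bool) {i} → f i ≡ true → g i ≡ false →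
  (∀ j → j ≢ i → f j ≡ g j) → ∣ tabulate f ∣ ≡ suc ∣ tabulate g ∣
∣tabulate∣-suc {suc n} f g {zero} fi gi f≗g rewrite fi | gi =
  cong suc (∣tabulate∣-cong λ j → f≗g (suc j) λ ())
∣tabulate∣-suc {suc n} f g {suc i} fi gi f≗g =
  trans (cong (λ b → ∣ b ∷ tabulate (f ∘ suc) ∣) (f≗g zero λ ()))
        (∣b∷p∣≡suc∣b∷q∣ (g zero) {p = tabulate (f ∘ suc)} {tabulate (g ∘ suc)}
          (∣tabulate∣-suc (f ∘ suc) (g ∘ suc) fi gi λ j j≢i → f≗g (suc j) (j≢i ∘ suc-injective)))

x∈p⇒x↑ˡ∈p++q : ∀ {m k} {p : Subset m} (q : Subset k) {x} → x ∈ p → x ↑ˡ k ∈ p ++ q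
x∈p⇒x↑ˡ∈p++q q here        = here
x∈p⇒x↑ˡ∈p++q q (there x∈p) = there (x∈p⇒x↑ˡ∈p++q q x∈p)

x↑ˡ∈p++q⇒x∈p : ∀ {m k} (p : Subset m) (q : Subset k) x → x ↑ˡ k ∈ p ++ q → x ∈ p
x↑ˡ∈p++q⇒x∈p (_ ∷ p) q zero    here        = here
x↑ˡ∈p++q⇒x∈p (_ ∷ p) q (suc x) (there x∈p) = there (x↑ˡ∈p++q⇒x∈p p q x x∈p)

m↑ʳx∈p++q⇒x∈q : ∀ {m k} (p : Subset m) (q : Subset k) x → m ↑ʳ x ∈ p ++ q → x ∈ q
m↑ʳx∈p++q⇒x∈q []      q x x∈q         = x∈q
m↑ʳx∈p++q⇒x∈q (_ ∷ p) q x (there x∈q) = m↑ʳx∈p++q⇒x∈q p q x x∈q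

∧-true⁻ : ∀ {a b} → a ∧ b ≡ true → a ≡ true × b ≡ true
∧-true⁻ {true} b≡true = refl , b≡true

∨-true⁻ : ∀ {a b} → a ∨ b ≡ true → a ≡ true ⊎ b ≡ true
∨-true⁻ {true}  _        = inj₁ refl
∨-true⁻ {false} b≡true = inj₂ b≡true

≢true⇒≡false : ∀ {b} → b ≢ true → b ≡ false
≢true⇒≡false {true}  b≢true = contradiction refl b≢true
≢true⇒≡false {false} _      = refl

≡ᵇ-true⇒≡ : ∀ {a b} → (a ≡ᵇ b) ≡ true → a ≡ b
≡ᵇ-true⇒≡ {a} {b} e = ℕ.≡ᵇ⇒≡ a b (subst T (sym e) _)

≡⇒≡ᵇ-true : ∀ {a b} → a ≡ b → (a ≡ᵇ b) ≡ true
≡⇒≡ᵇ-true {zero}  refl = refl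
≡⇒≡ᵇ-true {suc a} refl = ≡⇒≡ᵇ-true {a} refl

⌊≟⌋-true⇒≡ : ∀ {n} {x y : Fin n} → ⌊ x ≟ y ⌋ ≡ true → x ≡ y
⌊≟⌋-true⇒≡ {x = x} {y} e with x ≟ y
... | yes x≡y = x≡y

⌊≟⌋-refl : ∀ {n} (x : Fin n) → ⌊ x ≟ x ⌋ ≡ true
⌊≟⌋-refl x = trans (isYes≗does (x ≟ x)) (dec-true (x ≟ x) refl)

alternate : ∀ {K} → Fin K → Fin K → ℕ → Fin K
alternate a b zero    = b
alternate a b (suc i) = alternate b a i

alternate-≢-suc : ∀ {K} {a b : Fin K} → a ≢ b → ∀ i → alternate a b i ≢ alternate a b (suc i)
alternate-≢-suc a≢b zero    = a≢b ∘ sym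
alternate-≢-suc a≢b (suc i) = alternate-≢-suc (a≢b ∘ sym) i

alternate-odd : ∀ {K} (a b : Fin K) r → alternate a b (suc (r * 2)) ≡ a
alternate-odd a b zero    = refl
alternate-odd a b (suc r) = alternate-odd a b r

module Subdivision {m : ℕ} (G : Graph m) (u v : Fin m) (k : ℕ) where
  open ≡-Reasoning

  H : Graph (m + k)
  H = subdivideOne G u v k

  data View : Fin (m + k) → Set where
    old : (x : Fin m) → View (x ↑ˡ k)
    new : (i : Fin k) → View (m ↑ʳ i)

  view : ∀ z → View z
  view z with splitAt m {k} z in eq
  ... | inj₁ x = subst View (splitAt⁻¹-↑ˡ eq) (old x)
  ... | inj₂ i = subst View (splitAt⁻¹-↑ʳ eq) (new i)

  IsUV : Fin m → Fin m → Set
  IsUV x y = (x ≡ u × y ≡ v) ⊎ (x ≡ v × y ≡ u)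

  isUV? : ∀ x y → Dec (IsUV x y)
  isUV? x y = (x ≟ u ×-dec y ≟ v) ⊎-dec (x ≟ v ×-dec y ≟ u)

  H-old-old : ∀ x y → H (x ↑ˡ k) (y ↑ˡ k) ≡ G x y ∧ not ⌊ isUV? x y ⌋
  H-old-old x y rewrite splitAt-↑ˡ m x k | splitAt-↑ˡ m y k
    | isYes≗does (isUV? x y) | isYes≗does (x ≟ u) | isYes≗does (y ≟ v)
    | isYes≗does (x ≟ v) | isYes≗does (y ≟ u) = refl

  H-old-new : ∀ x j → H (x ↑ˡ k) (m ↑ʳ j) ≡
    (⌊ x ≟ u ⌋ ∧ (toℕ j ≡ᵇ 0)) ∨ (⌊ x ≟ v ⌋ ∧ (suc (toℕ j) ≡ᵇ k))
  H-old-new x j rewrite splitAt-↑ˡ m x k | splitAt-↑ʳ m k j = refl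

  H-new-old : ∀ i y → H (m ↑ʳ i) (y ↑ˡ k) ≡ H (y ↑ˡ k) (m ↑ʳ i)
  H-new-old i y rewrite splitAt-↑ˡ m y k | splitAt-↑ʳ m k i = refl

  H-new-new : ∀ i j → H (m ↑ʳ i) (m ↑ʳ j) ≡ (suc (toℕ i) ≡ᵇ toℕ j) ∨ (suc (toℕ j) ≡ᵇ toℕ i)
  H-new-new i j rewrite splitAt-↑ʳ m k i | splitAt-↑ʳ m k j = refl

  H-old-old-≡ : ∀ {x y} → ¬ IsUV x y → H (x ↑ˡ k) (y ↑ˡ k) ≡ G x y
  H-old-old-≡ {x} {y} ¬uv rewrite H-old-old x y with isUV? x y
  ... | yes uv = contradiction uv ¬uv
  ... | no  _  = ∧-identityʳ (G x y)

  H-old-old-uv : ∀ {x y} → IsUV x y → H (x ↑ˡ k) (y ↑ˡ k) ≡ false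
  H-old-old-uv {x} {y} uv rewrite H-old-old x y with isUV? x y
  ... | yes _   = ∧-zeroʳ (G x y)
  ... | no  ¬uv = contradiction uv ¬uv

  H-old-old⇒G : ∀ {x y} → H (x ↑ˡ k) (y ↑ˡ k) ≡ true → G x y ≡ true
  H-old-old⇒G {x} {y} e = proj₁ (∧-true⁻ (trans (sym (H-old-old x y)) e))

  H-old-new⁻ : ∀ {x j} → H (x ↑ˡ k) (m ↑ʳ j) ≡ true →
    (x ≡ u × toℕ j ≡ 0) ⊎ (x ≡ v × suc (toℕ j) ≡ k)
  H-old-new⁻ {x} {j} e = Sum.map (Product.map ⌊≟⌋-true⇒≡ ≡ᵇ-true⇒≡ ∘ ∧-true⁻)
                                 (Product.map ⌊≟⌋-true⇒≡ ≡ᵇ-true⇒≡ ∘ ∧-true⁻)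
                                 (∨-true⁻ (trans (sym (H-old-new x j)) e))

  H-new-new⁻ : ∀ {i j} → H (m ↑ʳ i) (m ↑ʳ j) ≡ true → suc (toℕ i) ≡ toℕ j ⊎ suc (toℕ j) ≡ toℕ i
  H-new-new⁻ {i} {j} e = Sum.map ≡ᵇ-true⇒≡ ≡ᵇ-true⇒≡ (∨-true⁻ (trans (sym (H-new-new i j)) e))

  H-u-first : ∀ {j} → toℕ j ≡ 0 → H (u ↑ˡ k) (m ↑ʳ j) ≡ true
  H-u-first {j} j≡0 rewrite H-old-new u j | ⌊≟⌋-refl u | ≡⇒≡ᵇ-true j≡0 = refl

  H-v-last : ∀ {j} → suc (toℕ j) ≡ k → H (v ↑ˡ k) (m ↑ʳ j) ≡ true
  H-v-last {j} j≡k-1 rewrite H-old-new v j | ⌊≟⌋-refl v | ≡⇒≡ᵇ-true j≡k-1 = ∨-zeroʳ _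

  H-path : ∀ {i j} → suc (toℕ i) ≡ toℕ j → H (m ↑ʳ i) (m ↑ʳ j) ≡ true
  H-path {i} {j} e rewrite H-new-new i j | ≡⇒≡ᵇ-true e = refl

  IsUV-sym : ∀ {x y} → IsUV x y → IsUV y x
  IsUV-sym = Sum.swap ∘ Sum.map Product.swap Product.swap

  subdivideOne-simple : Simple G → Simple H
  subdivideOne-simple (G-sym , G-irrefl) = H-sym , H-irrefl
    where
    H-old-old-sym : ∀ x y → H (x ↑ˡ k) (y ↑ˡ k) ≡ H (y ↑ˡ k) (x ↑ˡ k)
    H-old-old-sym x y with isUV? x y
    ... | yes uv = trans (H-old-old-uv uv) (sym (H-old-old-uv (IsUV-sym uv)))
    ... | no ¬uv = trans (H-old-old-≡ ¬uv) (trans (G-sym x y) (sym (H-old-old-≡ (¬uv ∘ IsUV-sym))))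
    H-sym : ∀ z w → H z w ≡ H w z
    H-sym z w with view z | view w
    ... | old x | old y = H-old-old-sym x y
    ... | old x | new j = sym (H-new-old j x)
    ... | new i | old y = H-new-old i y
    ... | new i | new j rewrite H-new-new i j | H-new-new j i = ∨-comm (suc (toℕ i) ≡ᵇ toℕ j) _
    H-irrefl : ∀ z → H z z ≡ false
    H-irrefl z = ≢true⇒≡false (loop z)
      where
      loop : ∀ z → H z z ≢ true
      loop z e with view z
      ... | old x = contradiction (trans (sym (H-old-old⇒G e)) (G-irrefl x)) λ ()
      ... | new i with H-new-new⁻ e
      ...   | inj₁ i+1≡i = ℕ.1+n≢n i+1≡i
      ...   | inj₂ i+1≡i = ℕ.1+n≢n i+1≡i

  edge⇒u≢v : Simple G → G u v ≡ true → u ≢ v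
  edge⇒u≢v (_ , G-irrefl) uv-edge refl = contradiction (trans (sym uv-edge) (G-irrefl u)) λ ()

  deg-endpoint : ∀ {x w} → G x w ≡ true → IsUV x w → (∀ {y} → y ≢ w → ¬ IsUV x y) →
    ∣ tabulate (λ j → H (x ↑ˡ k) (m ↑ʳ j)) ∣ ≡ 1 → deg H (x ↑ˡ k) ≡ deg G x
  deg-endpoint {x} {w} xw-edge xw-uv only-w new≡1 = begin
    deg H (x ↑ˡ k)                    ≡⟨ ∣tabulate∣-↑ m k (H (x ↑ˡ k)) ⟩
    ∣ tabulate Hxold ∣ + ∣ tabulate (λ j → H (x ↑ˡ k) (m ↑ʳ j)) ∣ ≡⟨ cong (∣ tabulate Hxold ∣ +_) new≡1 ⟩
    ∣ tabulate Hxold ∣ + 1            ≡⟨ ℕ.+-comm _ 1 ⟩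
    suc ∣ tabulate Hxold ∣            ≡⟨ ∣tabulate∣-suc (G x) Hxold xw-edge (H-old-old-uv xw-uv)
                                           (λ y y≢w → sym (H-old-old-≡ (only-w y≢w))) ⟨
    deg G x                           ∎
    where
    Hxold : Fin m → Bool
    Hxold y = H (x ↑ˡ k) (y ↑ˡ k)

  deg-old : Simple G → G u v ≡ true → ∀ {l} → k ≡ suc l → ∀ x → deg H (x ↑ˡ k) ≡ deg G x
  deg-old simple uv-edge {l} k≡1+l x with x ≟ u | x ≟ v
  ... | yes refl | _ =
    deg-endpoint uv-edge (inj₁ (refl , refl)) (λ y≢v → Sum.[ y≢v ∘ proj₂ , u≢v ∘ proj₁ ])
      (∣tabulate∣≡1 _ (H-u-first (toℕ-fromℕ< 0<k))
        λ e e′ → toℕ-injective (trans (first e) (sym (first e′))))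
    where
    u≢v = edge⇒u≢v simple uv-edge
    0<k = subst (0 <_) (sym k≡1+l) (s≤s z≤n)
    first : ∀ {j} → H (u ↑ˡ k) (m ↑ʳ j) ≡ true → toℕ j ≡ 0
    first e with H-old-new⁻ e
    ... | inj₁ (_ , j≡0)   = j≡0
    ... | inj₂ (u≡v , _)   = contradiction u≡v u≢v
  ... | no _ | yes refl =
    deg-endpoint (trans (proj₁ simple v u) uv-edge) (inj₂ (refl , refl))
      (λ y≢u → Sum.[ u≢v ∘ sym ∘ proj₁ , y≢u ∘ proj₂ ])
      (∣tabulate∣≡1 _ (H-v-last (trans (cong suc (toℕ-fromℕ< l<k)) (sym k≡1+l)))
        λ e e′ → toℕ-injective (ℕ.suc-injective (trans (last e) (sym (last e′)))))
    where
    u≢v = edge⇒u≢v simple uv-edge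
    l<k = subst (l <_) (sym k≡1+l) (ℕ.n<1+n l)
    last : ∀ {j} → H (v ↑ˡ k) (m ↑ʳ j) ≡ true → suc (toℕ j) ≡ k
    last e with H-old-new⁻ e
    ... | inj₁ (v≡u , _)     = contradiction (sym v≡u) u≢v
    ... | inj₂ (_ , j+1≡k)   = j+1≡k
  ... | no x≢u | no x≢v = begin
    deg H (x ↑ˡ k)                          ≡⟨ ∣tabulate∣-↑ m k (H (x ↑ˡ k)) ⟩
    ∣ tabulate Hxold ∣ + ∣ tabulate Hxnew ∣ ≡⟨ cong₂ _+_ (∣tabulate∣-cong {f = Hxold} λ _ → H-old-old-≡ ¬uv)
                                                       (∣tabulate∣≡0 Hxnew λ _ → ¬uv ∘ H-old-new⁻) ⟩
    deg G x + 0                             ≡⟨ ℕ.+-identityʳ _ ⟩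
    deg G x                                 ∎
    where
    Hxold : Fin m → Bool
    Hxold y = H (x ↑ˡ k) (y ↑ˡ k)
    Hxnew : Fin k → Bool
    Hxnew j = H (x ↑ˡ k) (m ↑ʳ j)
    ¬uv : ∀ {A B : Set} → ¬ ((x ≡ u × A) ⊎ (x ≡ v × B))
    ¬uv = Sum.[ x≢u ∘ proj₁ , x≢v ∘ proj₁ ]

  deg-new : ∀ i → deg H (m ↑ʳ i) ≤ 4
  deg-new i = subst (_≤ 4) (sym (∣tabulate∣-↑ m k (H (m ↑ʳ i))))
    (ℕ.+-mono-≤ (∣tabulate∣≤2 _ (λ p q → trans p (sym q)) (λ p q → trans p (sym q)) old-nbr)
                (∣tabulate∣≤2 _ (λ p q → toℕ-injective (trans (sym p) q))
                                (λ p q → toℕ-injective (ℕ.suc-injective (trans p (sym q))))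
                                (λ j → H-new-new⁻)))
    where
    old-nbr : ∀ y → H (m ↑ʳ i) (y ↑ˡ k) ≡ true → y ≡ u ⊎ y ≡ v
    old-nbr y e = Sum.map proj₁ proj₁ (H-old-new⁻ (trans (sym (H-new-old i y)) e))


  restrict : ∀ {K R T} (c : Fin (m + k) → Fin K) → Proper H T c →
    (∀ x → x ↑ˡ k ∈ T → x ∈ R) → (u ∉ R → v ∉ R → c (u ↑ˡ k) ≢ c (v ↑ˡ k)) → Colourable∖ G R K
  restrict {R = R} c proper T⊆R uv-ok = c ∘ (_↑ˡ k) , proper′
    where
    proper′ : Proper G R (c ∘ (_↑ˡ k))
    proper′ x y x∉R y∉R xy with isUV? x y
    ... | yes (inj₁ (refl , refl)) = uv-ok x∉R y∉R
    ... | yes (inj₂ (refl , refl)) = uv-ok y∉R x∉R ∘ sym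
    ... | no ¬uv = proper _ _ (x∉R ∘ T⊆R x) (y∉R ∘ T⊆R y) (trans (H-old-old-≡ ¬uv) xy)

  restrict-cut : ∀ {K R T} → Colourable∖ H T K → (∀ x → x ↑ˡ k ∈ T → x ∈ R) →
    u ∈ R ⊎ v ∈ R → Colourable∖ G R K
  restrict-cut (c , proper) T⊆R u∈R⊎v∈R =
    restrict c proper T⊆R λ u∉R v∉R → contradiction u∈R⊎v∈R Sum.[ u∉R , v∉R ]

  old≢new : ∀ x j → x ↑ˡ k ≢ m ↑ʳ j
  old≢new x j e with () ← trans (sym (splitAt-↑ˡ m x k)) (trans (cong (splitAt m) e) (splitAt-↑ʳ m k j))

  old∈pair⁻ : ∀ {z x y : Fin m} → z ↑ˡ k ∈ ⁅ x ↑ˡ k ⁆ ∪ ⁅ y ↑ˡ k ⁆ → z ∈ ⁅ x ⁆ ∪ ⁅ y ⁆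
  old∈pair⁻ {z} {x} {y} z∈ with x∈⁅y⁆∪⁅z⁆⁻ z∈
  ... | inj₁ e = subst (_∈ ⁅ x ⁆ ∪ ⁅ y ⁆) (sym (↑ˡ-injective k z x e)) (x∈⁅x⁆∪⁅y⁆ x y)
  ... | inj₂ e = subst (_∈ ⁅ x ⁆ ∪ ⁅ y ⁆) (sym (↑ˡ-injective k z y e)) (y∈⁅x⁆∪⁅y⁆ x y)

  old∈pair⁺ : ∀ {z x y : Fin m} → z ∈ ⁅ x ⁆ ∪ ⁅ y ⁆ → z ↑ˡ k ∈ ⁅ x ↑ˡ k ⁆ ∪ ⁅ y ↑ˡ k ⁆
  old∈pair⁺ {z} {x} {y} z∈ with x∈⁅y⁆∪⁅z⁆⁻ z∈
  ... | inj₁ refl = x∈⁅x⁆∪⁅y⁆ _ _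
  ... | inj₂ refl = y∈⁅x⁆∪⁅y⁆ _ _

  new∉old-pair : ∀ {x y : Fin m} j → m ↑ʳ j ∉ ⁅ x ↑ˡ k ⁆ ∪ ⁅ y ↑ˡ k ⁆
  new∉old-pair {x} {y} j j∈ = Sum.[ old≢new x j ∘ sym , old≢new y j ∘ sym ] (x∈⁅y⁆∪⁅z⁆⁻ j∈)

  restrict-cut-pair : ∀ {T} {x w : Fin m} → Bipartite∖ H T → (∀ z → z ↑ˡ k ∈ T → z ≡ x) →
    w ≡ u ⊎ w ≡ v → Bipartite∖ G (⁅ w ⁆ ∪ ⁅ x ⁆)
  restrict-cut-pair {x = x} {w} bip T-old≡x w≡u⊎v = restrict-cut bip
    (λ z z∈T → subst (_∈ ⁅ w ⁆ ∪ ⁅ x ⁆) (sym (T-old≡x z z∈T)) (y∈⁅x⁆∪⁅y⁆ w x))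
    (Sum.map (λ { refl → x∈⁅x⁆∪⁅y⁆ w x }) (λ { refl → x∈⁅x⁆∪⁅y⁆ w x }) w≡u⊎v)

  module Even (r : ℕ) (k≡ : k ≡ suc r * 2) where

    -- The path u, m ↑ʳ 0, …, m ↑ʳ (k-1), v gets the colours a, b, a, b, …, a, b,
    -- which fits exactly because k is even.
    extend : ∀ {K R T} → (c : Fin m → Fin K) → Proper G R c →
      (a b : Fin K) → a ≢ b → (u ∉ R → c u ≡ a) → (v ∉ R → c v ≡ b) →
      (∀ x → x ∈ R → x ↑ˡ k ∈ T) → Colourable∖ H T K
    extend {K} {R} {T} c proper a b a≢b cu≡a cv≡b R⊆T = c′ , proper′
      where
      c′ : Fin (m + k) → Fin K
      c′ z = Sum.[ c , alternate a b ∘ toℕ ]′ (splitAt m z)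
      c′-old : ∀ x → c′ (x ↑ˡ k) ≡ c x
      c′-old x rewrite splitAt-↑ˡ m x k = refl
      c′-new : ∀ j → c′ (m ↑ʳ j) ≡ alternate a b (toℕ j)
      c′-new j rewrite splitAt-↑ʳ m k j = refl
      ∉R : ∀ {x} → x ↑ˡ k ∉ T → x ∉ R
      ∉R {x} x∉T = x∉T ∘ R⊆T x
      old-new : ∀ x j → x ↑ˡ k ∉ T → H (x ↑ˡ k) (m ↑ʳ j) ≡ true → c x ≢ alternate a b (toℕ j)
      old-new x j x∉T e with H-old-new⁻ e
      ... | inj₁ (refl , j≡0) rewrite j≡0 | cu≡a (∉R x∉T) = a≢b
      ... | inj₂ (refl , j+1≡k) rewrite ℕ.suc-injective (trans j+1≡k k≡) | alternate-odd a b r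
                                       | cv≡b (∉R x∉T) = a≢b ∘ sym
      proper′ : Proper H T c′
      proper′ z w z∉T w∉T e with view z | view w
      ... | old x | old y rewrite c′-old x | c′-old y = proper x y (∉R z∉T) (∉R w∉T) (H-old-old⇒G e)
      ... | old x | new j rewrite c′-old x | c′-new j = old-new x j z∉T e
      ... | new i | old y rewrite c′-new i | c′-old y =
        old-new y i w∉T (trans (sym (H-new-old i y)) e) ∘ sym
      ... | new i | new j rewrite c′-new i | c′-new j with H-new-new⁻ e
      ...   | inj₁ i+1≡j rewrite sym i+1≡j = alternate-≢-suc a≢b (toℕ i)
      ...   | inj₂ j+1≡i rewrite sym j+1≡i = alternate-≢-suc a≢b (toℕ j) ∘ sym

    extend-colorable : ∀ {K} → G u v ≡ true → Colorable G K → Colorable H K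
    extend-colorable uv-edge col with colorable⇒colourable∖⊥ col
    ... | c , proper = colourable∖⊥⇒colorable
      (extend c proper (c u) (c v) (proper u v ∉⊥ ∉⊥ uv-edge) (λ _ → refl) (λ _ → refl)
        (λ _ → ⊥-elim ∘ ∉⊥))

    extend-bipartite∖ : ∀ {R T} → G u v ≡ true → Bipartite∖ G R →
      (∀ x → x ∈ R → x ↑ˡ k ∈ T) → Bipartite∖ H T
    extend-bipartite∖ {R} uv-edge (c , proper) R⊆T with u ∈? R | v ∈? R
    ... | no u∉R | _ =
      extend c proper (c u) (opposite (c u)) (opposite-≢ (c u)) (λ _ → refl)
        (λ v∉R → Fin2-≢-≢ (proper u v u∉R v∉R uv-edge) (opposite-≢ (c u))) R⊆T
    ... | yes u∈R | no _ =
      extend c proper (opposite (c v)) (c v) (opposite-≢ (c v) ∘ sym)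
        (contradiction u∈R) (λ _ → refl) R⊆T
    ... | yes u∈R | yes v∈R =
      extend c proper zero (suc zero) (λ ()) (contradiction u∈R) (contradiction v∈R) R⊆T

    -- On the intact path the two colours must alternate, so its ends u and v, an odd
    -- distance apart, get different colours.
    restrict-path : ∀ {R T} → Bipartite∖ H T →
      (∀ x → x ↑ˡ k ∈ T → x ∈ R) → (∀ j → m ↑ʳ j ∉ T) → Bipartite∖ G R
    restrict-path {R} {T} (c , proper) T⊆R new∉T = restrict c proper T⊆R ends-differ
      where
      ends-differ : u ∉ R → v ∉ R → c (u ↑ˡ k) ≢ c (v ↑ˡ k)
      ends-differ u∉R v∉R cu≡cv =
        proper _ _ (v∉R ∘ T⊆R v) (new∉T last) (H-v-last (trans (cong suc last≡) (sym k≡)))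
        (trans (sym cu≡cv) (sym (trans (path-colour _ last (toℕ-fromℕ< last<k)) (alternate-odd _ _ r))))
        where
        cu = c (u ↑ˡ k)
        path-colour : ∀ i (j : Fin k) → toℕ j ≡ i → c (m ↑ʳ j) ≡ alternate cu (opposite cu) i
        path-colour zero j j≡0 =
          Fin2-≢-≢ (proper _ _ (u∉R ∘ T⊆R u) (new∉T j) (H-u-first j≡0)) (opposite-≢ cu)
        path-colour (suc i) j j≡1+i =
          Fin2-≢-≢ (λ e → proper _ _ (new∉T prev) (new∉T j) (H-path (trans (cong suc prev≡) (sym j≡1+i)))
                           (trans (path-colour i prev prev≡) e))
                   (alternate-≢-suc (opposite-≢ cu) i)
          where
          i<k : i < k
          i<k = ℕ.<-trans (ℕ.n<1+n i) (subst (_< k) j≡1+i (toℕ<n j))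
          prev = fromℕ< i<k
          prev≡ = toℕ-fromℕ< i<k
        last<k : suc (r * 2) < k
        last<k = subst (suc (r * 2) <_) (sym k≡) (ℕ.n<1+n _)
        last = fromℕ< last<k
        last≡ : toℕ last ≡ suc (r * 2)
        last≡ = toℕ-fromℕ< last<k

    restrict-old-pair : ∀ {x y : Fin m} → Bipartite∖ H (⁅ x ↑ˡ k ⁆ ∪ ⁅ y ↑ˡ k ⁆) →
      Bipartite∖ G (⁅ x ⁆ ∪ ⁅ y ⁆)
    restrict-old-pair bip = restrict-path bip (λ _ → old∈pair⁻) new∉old-pair

-- C_χ(G) with χ(G - {x, y}) ≤ 2 in place of = 2; the two agree on S_n (FromInS.InC′⇒InC).
InC′ : ∀ {n} → Graph n → Fin n → Set
InC′ G x = ∃ λ y → Bipartite∖ G (⁅ x ⁆ ∪ ⁅ y ⁆)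

-- InS without the bound on the order, recast in terms of which deletions of at most
-- two vertices leave a bipartite graph (FromInS.inS′, ToInS.inS).
record InS′ {n} (G : Graph n) : Set where
  field
    simple                   : Simple G
    deg≤4                    : ∀ x → deg G x ≤ 4
    deg≡4                    : ∃ λ x → deg G x ≡ 4
    colorable₃               : Colorable G 3
    nonadjacent-¬bipartite∖  : ∀ x y → G x y ≡ false → ¬ Bipartite∖ G (⁅ x ⁆ ∪ ⁅ y ⁆)
    pair-bipartite∖          : ∃₂ λ x y → Bipartite∖ G (⁅ x ⁆ ∪ ⁅ y ⁆)
    independent-bipartite∖   : ∃ λ S → ∣ S ∣ ≡ 3 × Independent G S × Bipartite∖ G S

module _ {n} {G : Graph n} where

  module FromInS (G∈S : InS G) where

    simple : Simple G
    simple = proj₁ (proj₂ G∈S)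

    threeChromatic : ThreeChromatic G
    threeChromatic = Chi⇒threeChromatic (proj₁ (proj₂ (proj₂ (proj₂ G∈S))))

    ivs : Ivs G 3
    ivs = proj₁ (proj₂ (proj₂ (proj₂ (proj₂ G∈S))))

    vs : Vs G 2
    vs = proj₂ (proj₂ (proj₂ (proj₂ (proj₂ G∈S))))

    ¬bipartite∖⁅x⁆ : ∀ x → ¬ Bipartite∖ G ⁅ x ⁆
    ¬bipartite∖⁅x⁆ x bip =
      contradiction (proj₂ vs ⁅ x ⁆ reduces) (ℕ.<⇒≱ (ℕ.≤-reflexive (cong suc (∣⁅x⁆∣≡1 x))))
      where
      reduces : Reduces G ⁅ x ⁆
      reduces = subst (Reduces G) (∪-identityˡ ⁅ x ⁆)
        (bipartite∖-∪⁅⁆⇒reduces threeChromatic (proj₂ simple) x (proj₂ threeChromatic)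
          (subst (Bipartite∖ G) (sym (∪-identityˡ ⁅ x ⁆)) bip))

    reduces-pair : ∀ x y → Bipartite∖ G (⁅ x ⁆ ∪ ⁅ y ⁆) → Reduces G (⁅ x ⁆ ∪ ⁅ y ⁆)
    reduces-pair x y = bipartite∖-∪⁅⁆⇒reduces threeChromatic (proj₂ simple) y (¬bipartite∖⁅x⁆ x)

    nonadjacent-¬bipartite∖ : ∀ x y → G x y ≡ false → ¬ Bipartite∖ G (⁅ x ⁆ ∪ ⁅ y ⁆)
    nonadjacent-¬bipartite∖ x y xy bip =
      ℕ.<⇒≱ (s≤s (∣⁅x⁆∪⁅y⁆∣≤2 x y)) (proj₂ ivs _ (independent-pair simple xy) (reduces-pair x y bip))

    pair-bipartite∖ : ∃₂ λ x y → Bipartite∖ G (⁅ x ⁆ ∪ ⁅ y ⁆)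
    pair-bipartite∖ with proj₁ vs
    ... | S , ∣S∣≡2 , reduces with ∣p∣≤2⇒p⊆⁅x⁆∪⁅y⁆ S (ℕ.≤-reflexive ∣S∣≡2)
    ...   | inj₁ S⊆⊥ = contradiction (colourable∖-⊆ S⊆⊥ (reduces⇒bipartite∖ threeChromatic reduces))
                                     (proj₂ threeChromatic)
    ...   | inj₂ (x , y , _ , _ , S⊆) =
      x , y , colourable∖-⊆ S⊆ (reduces⇒bipartite∖ threeChromatic reduces)

    independent-bipartite∖ : ∃ λ S → ∣ S ∣ ≡ 3 × Independent G S × Bipartite∖ G S
    independent-bipartite∖ with proj₁ ivs
    ... | S , ∣S∣≡3 , independent , reduces =
      S , ∣S∣≡3 , independent , reduces⇒bipartite∖ threeChromatic reduces

    inS′ : InS′ G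
    inS′ = record
      { simple                  = simple
      ; deg≤4                   = proj₁ (proj₁ (proj₂ (proj₂ G∈S)))
      ; deg≡4                   = proj₂ (proj₁ (proj₂ (proj₂ G∈S)))
      ; colorable₃              = proj₁ threeChromatic
      ; nonadjacent-¬bipartite∖ = nonadjacent-¬bipartite∖
      ; pair-bipartite∖         = pair-bipartite∖
      ; independent-bipartite∖  = independent-bipartite∖
      }

    InC′⇒InC : ∀ {x} → InC′ G x → InC G x
    InC′⇒InC {x} (y , bip) = y , reduces⇒ChiMinus₂ threeChromatic (reduces-pair x y bip)

  module ToInS (G∈S′ : InS′ G) where
    open InS′ G∈S′

    ¬bipartite∖-⊆ : ∀ {S x y} → G x y ≡ false → S ⊆ ⁅ x ⁆ ∪ ⁅ y ⁆ → ¬ Bipartite∖ G S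
    ¬bipartite∖-⊆ xy S⊆ = nonadjacent-¬bipartite∖ _ _ xy ∘ colourable∖-⊆ S⊆

    ¬bipartite∖-⊆⁅⁆ : ∀ {S} x → S ⊆ ⁅ x ⁆ → ¬ Bipartite∖ G S
    ¬bipartite∖-⊆⁅⁆ x S⊆ = ¬bipartite∖-⊆ (proj₂ simple x) (p⊆p∪q ⁅ x ⁆ ∘ S⊆)

    threeChromatic : ThreeChromatic G
    threeChromatic = colorable₃ , ¬bipartite∖-⊆⁅⁆ (proj₁ deg≡4) ⊥⊆

    ¬bipartite∖-small : ∀ {S} → ∣ S ∣ ≤ 1 → ¬ Bipartite∖ G S
    ¬bipartite∖-small {S} ∣S∣≤1 with ∣p∣≤1⇒p⊆⁅x⁆ S ∣S∣≤1
    ... | inj₁ S⊆⊥       = ¬bipartite∖-⊆⁅⁆ (proj₁ deg≡4) (⊥⊆ ∘ S⊆⊥)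
    ... | inj₂ (x , S⊆)  = ¬bipartite∖-⊆⁅⁆ x S⊆

    vs : Vs G 2
    vs = witness pair-bipartite∖ , λ S reduces →
      ℕ.≰⇒> λ ∣S∣≤1 → ¬bipartite∖-small ∣S∣≤1 (reduces⇒bipartite∖ threeChromatic reduces)
      where
      witness : (∃₂ λ x y → Bipartite∖ G (⁅ x ⁆ ∪ ⁅ y ⁆)) → Σ (Subset n) λ S → ∣ S ∣ ≡ 2 × Reduces G S
      witness (x , y , bip) = ⁅ x ⁆ ∪ ⁅ y ⁆ , ∣⁅x⁆∪⁅y⁆∣≡2 x≢y ,
        bipartite∖-∪⁅⁆⇒reduces threeChromatic (proj₂ simple) y (¬bipartite∖-⊆⁅⁆ x id) bip
        where
        x≢y : x ≢ y
        x≢y refl = nonadjacent-¬bipartite∖ x x (proj₂ simple x) bip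

    ivs : Ivs G 3
    ivs = witness independent-bipartite∖ , λ S independent reduces →
      ℕ.≰⇒> λ ∣S∣≤2 → ¬bipartite∖-small′ S independent ∣S∣≤2 (reduces⇒bipartite∖ threeChromatic reduces)
      where
      witness : (∃ λ S → ∣ S ∣ ≡ 3 × Independent G S × Bipartite∖ G S) →
        Σ (Subset n) λ S → ∣ S ∣ ≡ 3 × Independent G S × Reduces G S
      witness (S , ∣S∣≡3 , independent , bip) = S , ∣S∣≡3 , independent ,
        bipartite∖⇒reduces threeChromatic bip
          (proj₂ threeChromatic ∘ independent-colorableMinus-1⇒bipartite independent)
      ¬bipartite∖-small′ : ∀ S → Independent G S → ∣ S ∣ ≤ 2 → ¬ Bipartite∖ G S
      ¬bipartite∖-small′ S independent ∣S∣≤2 with ∣p∣≤2⇒p⊆⁅x⁆∪⁅y⁆ S ∣S∣≤2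
      ... | inj₁ S⊆⊥ = ¬bipartite∖-⊆⁅⁆ (proj₁ deg≡4) (⊥⊆ ∘ S⊆⊥)
      ... | inj₂ (x , y , x∈S , y∈S , S⊆) = ¬bipartite∖-⊆ (independent x y x∈S y∈S) S⊆

    inS : 9 ≤ n → InS G
    inS 9≤n = 9≤n , simple , (deg≤4 , deg≡4) , threeChromatic⇒Chi threeChromatic , ivs , vs

module SubdivisionStep {m} (G : Graph m) (u v : Fin m) {k} (r : ℕ) (k≡ : k ≡ suc r * 2) where
  open Subdivision G u v k
  open Even r k≡

  cut⇒InC′ : ∀ {T x w} → Bipartite∖ H T → (∀ z → z ↑ˡ k ∈ T → z ≡ x) → w ≡ u ⊎ w ≡ v → InC′ G w
  cut⇒InC′ {x = x} bip T-old≡x w≡u⊎v = x , restrict-cut-pair bip T-old≡x w≡u⊎v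

  ∈old-new⁻ : ∀ {z x j} → z ↑ˡ k ∈ ⁅ x ↑ˡ k ⁆ ∪ ⁅ m ↑ʳ j ⁆ → z ≡ x
  ∈old-new⁻ {z} {x} {j} z∈ = Sum.[ ↑ˡ-injective k z x , ⊥-elim ∘ old≢new z j ] (x∈⁅y⁆∪⁅z⁆⁻ z∈)

  InC′-old⁻ : ∀ {x} → InC′ H (x ↑ˡ k) → InC′ G x
  InC′-old⁻ {x} (w , bip) with view w
  ... | old y = y , restrict-old-pair bip
  ... | new j =
    u , colourable∖-⊆ (⁅x⁆∪⁅y⁆⊆⁅y⁆∪⁅x⁆ u x) (restrict-cut-pair bip (λ _ → ∈old-new⁻) (inj₁ refl))

  module _ (G∈S′ : InS′ G) (uv-edge : G u v ≡ true) (¬both : ¬ (InC′ G u × InC′ G v)) where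
    open InS′ G∈S′

    nonadjacent-old : ∀ x y → H (x ↑ˡ k) (y ↑ˡ k) ≡ false → ¬ Bipartite∖ G (⁅ x ⁆ ∪ ⁅ y ⁆)
    nonadjacent-old x y xy bip with isUV? x y
    ... | yes (inj₁ (refl , refl)) = ¬both ((v , bip) , (u , colourable∖-⊆ (⁅x⁆∪⁅y⁆⊆⁅y⁆∪⁅x⁆ u v) bip))
    ... | yes (inj₂ (refl , refl)) = ¬both ((v , colourable∖-⊆ (⁅x⁆∪⁅y⁆⊆⁅y⁆∪⁅x⁆ v u) bip) , (u , bip))
    ... | no ¬uv = nonadjacent-¬bipartite∖ x y (trans (sym (H-old-old-≡ ¬uv)) xy) bip

    -- Once u (or v) is deleted from G the edge uv is gone, so a 2-colouring of H - T
    -- restricts to both G - {u, x} and G - {v, x}.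
    cut-contradiction : ∀ {T x} → (∀ z → z ↑ˡ k ∈ T → z ≡ x) → ¬ Bipartite∖ H T
    cut-contradiction T-old≡x bip =
      ¬both (cut⇒InC′ bip T-old≡x (inj₁ refl) , cut⇒InC′ bip T-old≡x (inj₂ refl))

    H-nonadjacent-¬bipartite∖ : ∀ a b → H a b ≡ false → ¬ Bipartite∖ H (⁅ a ⁆ ∪ ⁅ b ⁆)
    H-nonadjacent-¬bipartite∖ a b ab bip with view a | view b
    ... | old x | old y = nonadjacent-old x y ab (restrict-old-pair bip)
    ... | old x | new j = cut-contradiction (λ _ → ∈old-new⁻) bip
    ... | new i | old y = cut-contradiction (λ _ → ∈old-new⁻) (colourable∖-⊆ (⁅x⁆∪⁅y⁆⊆⁅y⁆∪⁅x⁆ _ _) bip)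
    ... | new i | new j = cut-contradiction {x = u}
      (λ z z∈ → ⊥-elim (Sum.[ old≢new z i , old≢new z j ] (x∈⁅y⁆∪⁅z⁆⁻ z∈))) bip

    subdivideOne-InS′ : InS′ H
    subdivideOne-InS′ = record
      { simple                  = subdivideOne-simple simple
      ; deg≤4                   = H-deg≤4
      ; deg≡4                   = Product.map (_↑ˡ k) (trans (deg-old simple uv-edge k≡ _)) deg≡4
      ; colorable₃              = extend-colorable uv-edge colorable₃
      ; nonadjacent-¬bipartite∖ = H-nonadjacent-¬bipartite∖
      ; pair-bipartite∖         = H-pair-bipartite∖ pair-bipartite∖
      ; independent-bipartite∖  = H-independent-bipartite∖ independent-bipartite∖
      }
      where
      H-deg≤4 : ∀ z → deg H z ≤ 4
      H-deg≤4 z with view z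
      ... | old x = subst (_≤ 4) (sym (deg-old simple uv-edge k≡ x)) (deg≤4 x)
      ... | new i = deg-new i
      H-pair-bipartite∖ : (∃₂ λ x y → Bipartite∖ G (⁅ x ⁆ ∪ ⁅ y ⁆)) →
        ∃₂ λ x y → Bipartite∖ H (⁅ x ⁆ ∪ ⁅ y ⁆)
      H-pair-bipartite∖ (x , y , bip) = x ↑ˡ k , y ↑ˡ k , extend-bipartite∖ uv-edge bip (λ _ → old∈pair⁺)
      H-independent-bipartite∖ : (∃ λ S → ∣ S ∣ ≡ 3 × Independent G S × Bipartite∖ G S) →
        ∃ λ S → ∣ S ∣ ≡ 3 × Independent H S × Bipartite∖ H S
      H-independent-bipartite∖ (S , ∣S∣≡3 , independent , bip) =
        S ++ ⊥ , ∣S++⊥∣≡3 , independent′ , extend-bipartite∖ uv-edge bip (λ _ → x∈p⇒x↑ˡ∈p++q ⊥)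
        where
        ∣S++⊥∣≡3 : ∣ S ++ ⊥ ∣ ≡ 3
        ∣S++⊥∣≡3 = trans (∣p++q∣ S ⊥) (trans (cong (∣ S ∣ +_) (∣⊥∣≡0 k)) (trans (ℕ.+-identityʳ _) ∣S∣≡3))
        independent′ : Independent H (S ++ ⊥)
        independent′ z w z∈ w∈ with view z | view w
        ... | old x | old y = trans (H-old-old x y)
          (cong (λ b → b ∧ not ⌊ isUV? x y ⌋)
            (independent x y (x↑ˡ∈p++q⇒x∈p S ⊥ x z∈) (x↑ˡ∈p++q⇒x∈p S ⊥ y w∈)))
        ... | old x | new j = ⊥-elim (∉⊥ (m↑ʳx∈p++q⇒x∈q S ⊥ j w∈))
        ... | new i | _     = ⊥-elim (∉⊥ (m↑ʳx∈p++q⇒x∈q S ⊥ i z∈))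

positive-even : ∀ {k} → 1 ≤ k → 2 ∣ k → ∃ λ r → k ≡ suc r * 2
positive-even {suc _} _ (divides (suc r) k≡) = r , k≡

GoodSubFrom : ∀ {n m} → Graph m → n ≤ m → Sub n → Set
GoodSubFrom G p (u , v , k) =
  G (inject≤ u p) (inject≤ v p) ≡ true × ¬ (InC′ G (inject≤ u p) × InC′ G (inject≤ v p)) × 1 ≤ k × 2 ∣ k

subdivideFrom-InS′ : ∀ {n m} (G : Graph m) (p : n ≤ m) (es : List (Sub n)) → InS′ G →
  AllPairs DistinctEdges es → All (GoodSubFrom G p) es → InS′ (subdivideFrom G p es)
subdivideFrom-InS′ G p [] G∈S′ _ _ = G∈S′
subdivideFrom-InS′ {n} {m} G p ((u , v , k) ∷ es) G∈S′ (distinct ∷ distinct-es)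
  ((uv-edge , ¬both , 1≤k , 2∣k) ∷ good-es) with positive-even 1≤k 2∣k
... | r , k≡ = subdivideFrom-InS′ H p′ es (subdivideOne-InS′ G∈S′ uv-edge ¬both) distinct-es
                 (All.zipWith good′ (distinct , good-es))
  where
  open SubdivisionStep G (inject≤ u p) (inject≤ v p) r k≡
  open Subdivision G (inject≤ u p) (inject≤ v p) k using (H; H-old-old-≡)
  p′ : n ≤ m + k
  p′ = ℕ.≤-trans p (ℕ.m≤m+n m k)
  inject≤-p′ : ∀ w → inject≤ w p′ ≡ inject≤ w p ↑ˡ k
  inject≤-p′ w = toℕ-injective
    (trans (toℕ-inject≤ w p′) (sym (trans (toℕ-↑ˡ (inject≤ w p) k) (toℕ-inject≤ w p))))
  good′ : ∀ {e} → DistinctEdges (u , v , k) e × GoodSubFrom G p e → GoodSubFrom H p′ e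
  good′ {u′ , v′ , _} (distinct′ , uv′-edge , ¬both′ , 1≤k′ , 2∣k′)
    rewrite inject≤-p′ u′ | inject≤-p′ v′ =
    trans (H-old-old-≡ ¬uv) uv′-edge , (λ (Cu , Cv) → ¬both′ (InC′-old⁻ Cu , InC′-old⁻ Cv)) , 1≤k′ , 2∣k′
    where
    inj : ∀ {a b} → inject≤ a p ≡ inject≤ b p → a ≡ b
    inj = inject≤-injective p p _ _
    ¬uv = distinct′ ∘ Sum.map (λ (e₁ , e₂) → sym (inj e₁) , sym (inj e₂))
                              (λ (e₁ , e₂) → sym (inj e₂) , sym (inj e₁))

size≡+totalNew : ∀ {n} m (es : List (Sub n)) → size m es ≡ m + totalNew es
size≡+totalNew m []                  = sym (ℕ.+-identityʳ m)
size≡+totalNew m ((_ , _ , k) ∷ es) = trans (size≡+totalNew (m + k) es) (ℕ.+-assoc m k (totalNew es))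

proposition8 : (n : ℕ) → 9 ≤ n → (G : Graph n) → InS G →
    (es : List (Sub n)) → AllPairs DistinctEdges es → All (GoodSub G) es →
    size n es ≡ n + totalNew es × InS (subdivide G es)
proposition8 n 9≤n G G∈S es distinct good =
  size≡ , ToInS.inS (subdivideFrom-InS′ G ℕ.≤-refl es inS′ distinct (All.map goodFrom good)) 9≤size
  where
  open FromInS G∈S using (inS′; InC′⇒InC)
  size≡ = size≡+totalNew n es
  9≤size = subst (9 ≤_) (sym size≡) (ℕ.≤-trans 9≤n (ℕ.m≤m+n n (totalNew es)))
  goodFrom : ∀ {e} → GoodSub G e → GoodSubFrom G ℕ.≤-refl e
  goodFrom {u , v , _} good rewrite inject≤-refl u ℕ.≤-refl | inject≤-refl v ℕ.≤-refl =
    Product.map₂ (Product.map₁ λ ¬both (Cu , Cv) → ¬both (InC′⇒InC Cu , InC′⇒InC Cv)) good
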